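{- Let $n\ge1$, $m\ge2$, and let $H_{n,m}\subset\mathbb{R}^{n^m}$ be the H-cycle polytope, i.e. the set of $y=(y_{i_1\cdots i_m})_{(i_1,\ldots,i_m)\in[n]^m}$ satisfying \[ \sum_{(i_1,\ldots,i_m)\in[n]^m} y_{i_1\cdots i_m}\bigl((m-1)e_{i_1}-e_{i_2}-\cdots-e_{i_m}\bigr)=0,\qquad \sum_{(i_1,\ldots,i_m)\in[n]^m} y_{i_1\cdots i_m}=1,\qquad y_{i_1\cdots i_m}\ge0. \] If $y$ is a vertex of $H_{n,m}$, then for each $j=1,\ldots,n$, $y$ has at most one nonzero entry of the form $y_{j\,i_2\cdots i_m}$ (with first index $j$). Moreover, there exist vertices of $H_{n,m}$ with exactly $n$ nonzero entries.
   Context: $e_1,\ldots,e_n$ denote the standard basis vectors of $\mathbb{R}^n$.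
   Formalization: The H-cycle polytope is taken in ℚ^(n^m) in place of ℝ^(n^m), so vertices are extreme points among its rational points, with rational weights in the convex combinations. -}

module Defs where

open import Data.Nat using (ℕ; zero; suc)
open import Data.Integer using (ℤ; +_)
open import Data.Rational using (ℚ; 0ℚ; 1ℚ; _+_; _*_; _-_; _/_; _≤_; _<_)
open import Data.Fin using (Fin)
open import Data.Fin.Properties using () renaming (_≟_ to _≟ᶠ_)
open import Data.Vec using (Vec; []; _∷_; head; tail)
open import Data.List using (List; []; _∷_; concatMap; map; foldr; length; filter)
open import Data.List using (allFin) public
open import Data.Product using (_×_; Σ)
open import Relation.Nullary using (¬_; yes; no)
open import Relation.Nullary.Decidable using (¬?)
open import Relation.Binary.PropositionalEquality using (_≡_)
open import Data.Rational.Properties using () renaming (_≟_ to _≟ℚ_)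

ℕ→ℚ : ℕ → ℚ
ℕ→ℚ k = (+ k) / 1

δ : {n : ℕ} → Fin n → Fin n → ℚ
δ i k with i ≟ᶠ k
... | yes _ = 1ℚ
... | no  _ = 0ℚ

Σℚ : {A : Set} → List A → (A → ℚ) → ℚ
Σℚ xs f = foldr (λ x acc → f x + acc) 0ℚ xs

tuples : (n m : ℕ) → List (Vec (Fin n) m)
tuples n zero = [] ∷ []
tuples n (suc m) = concatMap (λ i → map (i ∷_) (tuples n m)) (allFin n)

Point : ℕ → ℕ → Set
Point n m = Vec (Fin n) m → ℚ

-- k-th coordinate of (m-1) e_{i₁} - e_{i₂} - ⋯ - e_{i_m}
-- (for m = 0 the vector is taken to be 0; irrelevant since m ≥ 2)
coeff : {n m : ℕ} → Vec (Fin n) m → Fin n → ℚ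
coeff {m = zero} [] k = 0ℚ
coeff {m = suc m} (i₁ ∷ rest) k =
  ℕ→ℚ m * δ i₁ k - Σℚ (Data.Vec.toList rest) (λ i → δ i k)

InH : (n m : ℕ) → Point n m → Set
InH n m y =
  ((k : Fin n) → Σℚ (tuples n m) (λ i → y i * coeff i k) ≡ 0ℚ)
  × (Σℚ (tuples n m) y ≡ 1ℚ)
  × ((i : Vec (Fin n) m) → 0ℚ ≤ y i)

IsVertex : (n m : ℕ) → Point n m → Set
IsVertex n m y =
  InH n m y ×
  ((y₁ y₂ : Point n m) (t : ℚ) → InH n m y₁ → InH n m y₂ → 0ℚ < t → t < 1ℚ →
    ((i : Vec (Fin n) m) → y i ≡ t * y₁ i + (1ℚ - t) * y₂ i) →
    (i : Vec (Fin n) m) → y₁ i ≡ y₂ i)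

nnz : (n m : ℕ) → Point n m → ℕ
nnz n m y = length (filter (λ i → ¬? (y i ≟ℚ 0ℚ)) (tuples n m))

open import Data.Empty using (⊥)
HasFirst : {n m : ℕ} → Vec (Fin n) m → Fin n → Set
HasFirst [] j = ⊥
HasFirst (i₁ ∷ _) j = i₁ ≡ j

-- Write the constraints of H_{n,m} as A y = 0, Σ y = 1, y ≥ 0, where column s of A is coeff s.
-- If a nonzero z with A z = 0 and Σ z = 0 is supported in supp y, then y ± ε z ∈ H for small
-- ε > 0 and y is their midpoint, so y is not a vertex. The rows of A sum to zero, and row c is
-- ≤ 0 except on tuples with first index c; since A y = 0, row c vanishes on supp y unless some
-- tuple of supp y starts with c. Given support tuples i ≠ i′ that both start with j, pick one
-- support tuple other than i′ for each first index that has one. Together with i′ these give at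
-- most n + 1 columns of A with row j replaced by the mass row, i.e. vectors in ℚⁿ, and a linear
-- dependence among them yields such a z.
-- For the second part put weight 1/n on each cycle tuple (k, k − 1, k, …, k), indices mod n:
-- flow conservation forces equal weights on the cycle, so this is the only point of H with that
-- support, hence a vertex with n nonzero entries.

module Submission where

open import Defs
open import Algebra.Bundles using (CommutativeRing)
open import Data.Nat using (ℕ; zero; suc; _≤_; s≤s)
import Data.Integer as ℤ
open import Data.Fin using (Fin; zero; suc; punchIn; inject₁; fromℕ)
open import Data.Fin.Properties using (punchInᵢ≢i; any?; fromℕ≢inject₁; inject₁-injective)
  renaming (_≟_ to _≟ᶠ_)
open import Data.Vec as Vec using (Vec; []; _∷_)
open import Data.Vec.Properties using (∷-injectiveˡ; ∷-injectiveʳ; toList-replicate; length-toList)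
  renaming (≡-dec to ≡-decⱽ)
open import Data.Vec.Functional using (Vector; replicate; insertAt)
open import Data.Vec.Functional.Properties using (insertAt-lookup; insertAt-punchIn)
open import Data.List as List using (List; []; _∷_; _++_; map; concatMap; filter; length)
open import Data.List.Properties using (length-tabulate)
open import Data.List.Membership.Propositional using (_∈_; lose)
open import Data.List.Membership.Propositional.Properties using (∈-map⁺; ∈-concat⁺′; ∈-allFin)
open import Data.List.Relation.Unary.Any as Any using (here; there)
open import Data.Maybe using (Maybe; just; nothing)
open import Data.Rational as ℚ using (ℚ; 0ℚ; 1ℚ; ½; _+_; _*_; _-_; -_; 1/_; ∣_∣; _⊓_; mkℚ)
import Data.Rational.Properties as ℚP
open import Data.Rational.Solver using (module +-*-Solver)
open import Data.Nat.Coprimality using (1-coprimeTo) renaming (sym to coprime-sym)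
open import Data.Product using (_×_; _,_; proj₁; proj₂; Σ; ∃; ∃-syntax)
open import Data.Sum using (inj₁; inj₂)
open import Data.Empty using (⊥; ⊥-elim)
open import Function using (_∘_; id)
open import Function.Definitions using (Injective)
open import Relation.Nullary using (¬_; Dec; yes; no)
open import Relation.Nullary.Decidable using (¬?; _×-dec_; decidable-stable; from-yes)
open import Relation.Binary.Definitions using (tri<; tri≈; tri>)
open import Relation.Binary.PropositionalEquality

open import Algebra.Properties.Semiring.Sum (CommutativeRing.semiring ℚP.+-*-commutativeRing)
  using (sum; sum-cong-≗; sum-remove; sum-init-last; ∑-distrib-+; sum-replicate-zero; *-distribˡ-sum; *-distribʳ-sum)
open +-*-Solver
open ≡-Reasoning

ℕ→ℚ≡mkℚ : ∀ k → ℕ→ℚ k ≡ mkℚ (ℤ.+ k) 0 (coprime-sym (1-coprimeTo k))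
ℕ→ℚ≡mkℚ k = ℚP.normalize-coprime (coprime-sym (1-coprimeTo k))

ℕ→ℚ-suc : ∀ k → ℕ→ℚ (suc k) ≡ 1ℚ + ℕ→ℚ k
ℕ→ℚ-suc k rewrite ℕ→ℚ≡mkℚ k = cong (λ z → (ℤ.+ 1 ℤ.+ z) ℚ./ 1) (sym (ℤP.*-identityʳ (ℤ.+ k)))
  where import Data.Integer.Properties as ℤP

ℕ→ℚ-suc-* : ∀ k x → ℕ→ℚ (suc k) * x ≡ x + ℕ→ℚ k * x
ℕ→ℚ-suc-* k x = trans (cong (_* x) (ℕ→ℚ-suc k)) (solve 2 (λ k x → (con 1ℚ :+ k) :* x := x :+ k :* x) refl (ℕ→ℚ k) x)

ℕ→ℚ-injective : ∀ {a b} → ℕ→ℚ a ≡ ℕ→ℚ b → a ≡ b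
ℕ→ℚ-injective {a} {b} e = ℤP.+-injective (cong ℚ.↥_ (trans (sym (ℕ→ℚ≡mkℚ a)) (trans e (ℕ→ℚ≡mkℚ b))))
  where import Data.Integer.Properties as ℤP

0<ℕ→ℚ-suc : ∀ k → 0ℚ ℚ.< ℕ→ℚ (suc k)
0<ℕ→ℚ-suc k = subst (0ℚ ℚ.<_) (sym (ℕ→ℚ≡mkℚ (suc k))) (ℚP.positive⁻¹ _)

p≡-q : ∀ {p q} → p + q ≡ 0ℚ → p ≡ - q
p≡-q {p} {q} p+q≡0 = begin
  p              ≡⟨ solve 2 (λ p q → p := (p :+ q) :- q) refl p q ⟩
  (p + q) - q    ≡⟨ cong (_- q) p+q≡0 ⟩
  0ℚ - q         ≡⟨ ℚP.+-identityˡ (- q) ⟩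
  - q            ∎

p+q≡0⇒p≡0-nonNeg : ∀ {p q} → 0ℚ ℚ.≤ p → 0ℚ ℚ.≤ q → p + q ≡ 0ℚ → p ≡ 0ℚ
p+q≡0⇒p≡0-nonNeg 0≤p 0≤q p+q≡0 = ℚP.≤-antisym (subst (ℚ._≤ 0ℚ) (sym (p≡-q p+q≡0)) (ℚP.neg-antimono-≤ 0≤q)) 0≤p

p+q≡0⇒p≡0-nonPos : ∀ {p q} → p ℚ.≤ 0ℚ → q ℚ.≤ 0ℚ → p + q ≡ 0ℚ → p ≡ 0ℚ
p+q≡0⇒p≡0-nonPos p≤0 q≤0 p+q≡0 = ℚP.≤-antisym p≤0 (subst (0ℚ ℚ.≤_) (sym (p≡-q p+q≡0)) (ℚP.neg-antimono-≤ q≤0))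

≤∧≢⇒< : ∀ {p q} → p ℚ.≤ q → p ≢ q → p ℚ.< q
≤∧≢⇒< {p} {q} p≤q p≢q with ℚP.<-cmp p q
... | tri< p<q _ _ = p<q
... | tri≈ _ p≡q _ = ⊥-elim (p≢q p≡q)
... | tri> _ _ p>q = ⊥-elim (ℚP.<-irrefl refl (ℚP.<-≤-trans p>q p≤q))

*-cancelˡ-≢0 : ∀ {p q r} → p ≢ 0ℚ → p * q ≡ p * r → q ≡ r
*-cancelˡ-≢0 {p} {q} {r} p≢0 pq≡pr = begin
  q                  ≡⟨ undo q ⟨
  1/ p * (p * q)     ≡⟨ cong (1/ p *_) pq≡pr ⟩
  1/ p * (p * r)     ≡⟨ undo r ⟩
  r                  ∎
  where
  instance _ = ℚ.≢-nonZero p≢0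
  undo : ∀ x → 1/ p * (p * x) ≡ x
  undo x = trans (sym (ℚP.*-assoc (1/ p) p x)) (trans (cong (_* x) (ℚP.*-inverseˡ p)) (ℚP.*-identityˡ x))

p*q≡0⇒q≡0 : ∀ {p q} → p ≢ 0ℚ → p * q ≡ 0ℚ → q ≡ 0ℚ
p*q≡0⇒q≡0 {p} p≢0 pq≡0 = *-cancelˡ-≢0 p≢0 (trans pq≡0 (sym (ℚP.*-zeroʳ p)))

p*q≤0 : ∀ {p q} → 0ℚ ℚ.≤ p → q ℚ.≤ 0ℚ → p * q ℚ.≤ 0ℚ
p*q≤0 {p} {q} 0≤p q≤0 = subst (p * q ℚ.≤_) (ℚP.*-zeroʳ p) (ℚP.*-monoˡ-≤-nonNeg p {{ℚ.nonNegative 0≤p}} q≤0)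

0≤p*q : ∀ {p q} → 0ℚ ℚ.≤ p → 0ℚ ℚ.≤ q → 0ℚ ℚ.≤ p * q
0≤p*q {p} {q} 0≤p 0≤q = subst (ℚ._≤ p * q) (ℚP.*-zeroʳ p) (ℚP.*-monoˡ-≤-nonNeg p {{ℚ.nonNegative 0≤p}} 0≤q)

∣q∣≤p⇒0≤p+q : ∀ {p q} → ∣ q ∣ ℚ.≤ p → 0ℚ ℚ.≤ p + q
∣q∣≤p⇒0≤p+q {p} {q} ∣q∣≤p with ℚP.∣p∣≡p∨∣p∣≡-p q
... | inj₁ ∣q∣≡q  = ℚP.+-mono-≤ (ℚP.≤-trans (ℚP.0≤∣p∣ q) ∣q∣≤p) (ℚP.∣p∣≡p⇒0≤p ∣q∣≡q)
... | inj₂ ∣q∣≡-q = subst (ℚ._≤ p + q) (ℚP.+-inverseˡ q) (ℚP.+-monoˡ-≤ q (subst (ℚ._≤ p) ∣q∣≡-q ∣q∣≤p))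

0<1 : 0ℚ ℚ.< 1ℚ
0<1 = ℚP.positive⁻¹ 1ℚ

0<½ : 0ℚ ℚ.< ½
0<½ = from-yes (0ℚ ℚ.<? ½)

½<1 : ½ ℚ.< 1ℚ
½<1 = from-yes (½ ℚ.<? 1ℚ)

p-q≡0⇒p≡q : ∀ {p q} → p - q ≡ 0ℚ → p ≡ q
p-q≡0⇒p≡q {p} {q} p-q≡0 = trans (solve 2 (λ p q → p := (p :- q) :+ q) refl p q) (trans (cong (_+ q) p-q≡0) (ℚP.+-identityˡ q))

module _ {A : Set} where

  Σℚ-cong : (xs : List A) {f g : A → ℚ} → (∀ x → f x ≡ g x) → Σℚ xs f ≡ Σℚ xs g
  Σℚ-cong []       f≗g = refl
  Σℚ-cong (x ∷ xs) f≗g = cong₂ _+_ (f≗g x) (Σℚ-cong xs f≗g)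

  Σℚ-zero : (xs : List A) {f : A → ℚ} → (∀ x → f x ≡ 0ℚ) → Σℚ xs f ≡ 0ℚ
  Σℚ-zero []       f≗0 = refl
  Σℚ-zero (x ∷ xs) f≗0 = cong₂ _+_ (f≗0 x) (Σℚ-zero xs f≗0)

  Σℚ-+ : (xs : List A) (f g : A → ℚ) → Σℚ xs (λ x → f x + g x) ≡ Σℚ xs f + Σℚ xs g
  Σℚ-+ []       f g = refl
  Σℚ-+ (x ∷ xs) f g = trans (cong ((f x + g x) +_) (Σℚ-+ xs f g))
    (solve 4 (λ a b c d → (a :+ b) :+ (c :+ d) := (a :+ c) :+ (b :+ d)) refl (f x) (g x) (Σℚ xs f) (Σℚ xs g))

  Σℚ-*ˡ : (xs : List A) (a : ℚ) (f : A → ℚ) → Σℚ xs (λ x → a * f x) ≡ a * Σℚ xs f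
  Σℚ-*ˡ []       a f = sym (ℚP.*-zeroʳ a)
  Σℚ-*ˡ (x ∷ xs) a f = trans (cong (a * f x +_) (Σℚ-*ˡ xs a f)) (sym (ℚP.*-distribˡ-+ a (f x) (Σℚ xs f)))

  Σℚ-perturb : (xs : List A) (f g : A → ℚ) (e : ℚ) → Σℚ xs (λ x → f x + e * g x) ≡ Σℚ xs f + e * Σℚ xs g
  Σℚ-perturb xs f g e = trans (Σℚ-+ xs f (λ x → e * g x)) (cong (Σℚ xs f +_) (Σℚ-*ˡ xs e g))

  Σℚ-const : (xs : List A) (a : ℚ) → Σℚ xs (λ _ → a) ≡ ℕ→ℚ (length xs) * a
  Σℚ-const []       a = sym (ℚP.*-zeroˡ a)
  Σℚ-const (x ∷ xs) a = trans (cong (a +_) (Σℚ-const xs a)) (sym (ℕ→ℚ-suc-* (length xs) a))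

  Σℚ-++ : (xs ys : List A) (f : A → ℚ) → Σℚ (xs ++ ys) f ≡ Σℚ xs f + Σℚ ys f
  Σℚ-++ []       ys f = sym (ℚP.+-identityˡ _)
  Σℚ-++ (x ∷ xs) ys f = trans (cong (f x +_) (Σℚ-++ xs ys f)) (sym (ℚP.+-assoc (f x) _ _))

  Σℚ-sum-comm : ∀ {k} (xs : List A) (f : A → Vector ℚ k) →
    Σℚ xs (λ x → sum (f x)) ≡ sum (λ r → Σℚ xs (λ x → f x r))
  Σℚ-sum-comm {k} []       f = sym (sum-replicate-zero k)
  Σℚ-sum-comm     (x ∷ xs) f = trans (cong (sum (f x) +_) (Σℚ-sum-comm xs f)) (sym (∑-distrib-+ (f x) _))

  Σℚ-combination : ∀ {k} (xs : List A) (a : Vector ℚ k) (f : Fin k → A → ℚ) →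
    Σℚ xs (λ x → sum (λ r → a r * f r x)) ≡ sum (λ r → a r * Σℚ xs (f r))
  Σℚ-combination xs a f = trans (Σℚ-sum-comm xs (λ x r → a r * f r x)) (sum-cong-≗ (λ r → Σℚ-*ˡ xs (a r) (f r)))

  Σℚ-replicate : ∀ k (x : A) (f : A → ℚ) → Σℚ (List.replicate k x) f ≡ ℕ→ℚ k * f x
  Σℚ-replicate zero    x f = sym (ℚP.*-zeroˡ (f x))
  Σℚ-replicate (suc k) x f = trans (cong (f x +_) (Σℚ-replicate k x f)) (sym (ℕ→ℚ-suc-* k (f x)))

  Σℚ-nonNeg : (xs : List A) {f : A → ℚ} → (∀ x → 0ℚ ℚ.≤ f x) → 0ℚ ℚ.≤ Σℚ xs f
  Σℚ-nonNeg []       _   = ℚP.≤-refl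
  Σℚ-nonNeg (x ∷ xs) 0≤f = ℚP.+-mono-≤ (0≤f x) (Σℚ-nonNeg xs 0≤f)

  Σℚ-nonPos : (xs : List A) {f : A → ℚ} → (∀ x → f x ℚ.≤ 0ℚ) → Σℚ xs f ℚ.≤ 0ℚ
  Σℚ-nonPos []       _   = ℚP.≤-refl
  Σℚ-nonPos (x ∷ xs) f≤0 = ℚP.+-mono-≤ (f≤0 x) (Σℚ-nonPos xs f≤0)

  Σℚ-nonPos-≡0 : (xs : List A) {f : A → ℚ} → (∀ x → f x ℚ.≤ 0ℚ) → Σℚ xs f ≡ 0ℚ → ∀ {x} → x ∈ xs → f x ≡ 0ℚ
  Σℚ-nonPos-≡0 (x ∷ xs) f≤0 Σ≡0 (here refl) = p+q≡0⇒p≡0-nonPos (f≤0 x) (Σℚ-nonPos xs f≤0) Σ≡0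
  Σℚ-nonPos-≡0 (x ∷ xs) {f} f≤0 Σ≡0 (there x∈xs) =
    Σℚ-nonPos-≡0 xs f≤0 (p+q≡0⇒p≡0-nonPos (Σℚ-nonPos xs f≤0) (f≤0 x) (trans (ℚP.+-comm _ (f x)) Σ≡0)) x∈xs

Σℚ-map : {A B : Set} (g : A → B) (xs : List A) (f : B → ℚ) → Σℚ (map g xs) f ≡ Σℚ xs (f ∘ g)
Σℚ-map g []       f = refl
Σℚ-map g (x ∷ xs) f = cong (f (g x) +_) (Σℚ-map g xs f)

Σℚ-concatMap : {A B : Set} (g : A → List B) (xs : List A) (f : B → ℚ) →
  Σℚ (concatMap g xs) f ≡ Σℚ xs (λ x → Σℚ (g x) f)
Σℚ-concatMap g []       f = refl
Σℚ-concatMap g (x ∷ xs) f = trans (Σℚ-++ (g x) (concatMap g xs) f) (cong (Σℚ (g x) f +_) (Σℚ-concatMap g xs f))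

Σℚ-tabulate : ∀ {A : Set} {k} (g : Fin k → A) (f : A → ℚ) → Σℚ (List.tabulate g) f ≡ sum (f ∘ g)
Σℚ-tabulate {k = zero}  g f = refl
Σℚ-tabulate {k = suc k} g f = cong (f (g zero) +_) (Σℚ-tabulate (g ∘ suc) f)

sum-const : ∀ k (a : ℚ) → sum (replicate k a) ≡ ℕ→ℚ k * a
sum-const k a = begin
  sum (replicate k a)                 ≡⟨ Σℚ-tabulate id (replicate k a) ⟨
  Σℚ (allFin k) (λ _ → a)             ≡⟨ Σℚ-const (allFin k) a ⟩
  ℕ→ℚ (length (allFin k)) * a         ≡⟨ cong (λ l → ℕ→ℚ l * a) (length-tabulate {n = k} id) ⟩
  ℕ→ℚ k * a                           ∎

sum-- : ∀ {k} (f g : Vector ℚ k) → sum (λ r → f r - g r) ≡ sum f - sum g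
sum-- {zero}  f g = refl
sum-- {suc k} f g = trans (cong (f zero - g zero +_) (sum-- (f ∘ suc) (g ∘ suc)))
  (solve 4 (λ a b c d → (a :- b) :+ (c :- d) := (a :+ c) :- (b :+ d)) refl (f zero) (g zero) _ _)

sum-single : ∀ {k} (a : Fin k) {f : Vector ℚ k} → (∀ r → r ≢ a → f r ≡ 0ℚ) → sum f ≡ f a
sum-single {suc k} a {f} f-off = begin
  sum f                               ≡⟨ sum-remove {i = a} f ⟩
  f a + sum (f ∘ punchIn a)           ≡⟨ cong (f a +_) (sum-cong-≗ (λ r → f-off (punchIn a r) (punchInᵢ≢i a r))) ⟩
  f a + sum (replicate k 0ℚ)          ≡⟨ cong (f a +_) (sum-replicate-zero k) ⟩
  f a + 0ℚ                            ≡⟨ ℚP.+-identityʳ (f a) ⟩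
  f a                                 ∎

χ : {A : Set} → Dec A → ℚ
χ (yes _) = 1ℚ
χ (no _)  = 0ℚ

χ-yes : {A : Set} (d : Dec A) → A → χ d ≡ 1ℚ
χ-yes (yes _) _ = refl
χ-yes (no ¬a) a = ⊥-elim (¬a a)

χ-no : {A : Set} (d : Dec A) → ¬ A → χ d ≡ 0ℚ
χ-no (yes a) ¬a = ⊥-elim (¬a a)
χ-no (no _)  _  = refl

χ-nonNeg : {A : Set} (d : Dec A) → 0ℚ ℚ.≤ χ d
χ-nonNeg (yes _) = ℚP.<⇒≤ 0<1
χ-nonNeg (no _)  = ℚP.≤-refl

ℕ→ℚ-length-filter : {A : Set} {P : A → Set} (P? : ∀ x → Dec (P x)) (xs : List A) →
  ℕ→ℚ (length (filter P? xs)) ≡ Σℚ xs (χ ∘ P?)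
ℕ→ℚ-length-filter P? []       = refl
ℕ→ℚ-length-filter P? (x ∷ xs) with P? x
... | yes _ = trans (ℕ→ℚ-suc (length (filter P? xs))) (cong (1ℚ +_) (ℕ→ℚ-length-filter P? xs))
... | no _  = trans (ℕ→ℚ-length-filter P? xs) (sym (ℚP.+-identityˡ _))

δ-refl : ∀ {n} (a : Fin n) → δ a a ≡ 1ℚ
δ-refl a with a ≟ᶠ a
... | yes _   = refl
... | no a≢a  = ⊥-elim (a≢a refl)

δ-≢ : ∀ {n} {a c : Fin n} → a ≢ c → δ a c ≡ 0ℚ
δ-≢ {a = a} {c} a≢c with a ≟ᶠ c
... | yes a≡c = ⊥-elim (a≢c a≡c)
... | no _    = refl

δ-nonNeg : ∀ {n} (a c : Fin n) → 0ℚ ℚ.≤ δ a c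
δ-nonNeg a c with a ≟ᶠ c
... | yes _ = ℚP.<⇒≤ 0<1
... | no _  = ℚP.≤-refl

sum-δ : ∀ {n} (a : Fin n) → sum (δ a) ≡ 1ℚ
sum-δ a = trans (sum-single a (λ c c≢a → δ-≢ (c≢a ∘ sym))) (δ-refl a)

sum-*δ : ∀ {n} (f : Vector ℚ n) (c : Fin n) → sum (λ k → f k * δ k c) ≡ f c
sum-*δ f c = trans (sum-single c (λ k k≢c → trans (cong (f k *_) (δ-≢ k≢c)) (ℚP.*-zeroʳ (f k))))
                   (trans (cong (f c *_) (δ-refl c)) (ℚP.*-identityʳ (f c)))

small-multiplier₁ : ∀ {a b} → 0ℚ ℚ.≤ a → (b ≢ 0ℚ → 0ℚ ℚ.< a) → ∃[ ε ] 0ℚ ℚ.< ε × ε * ∣ b ∣ ℚ.≤ a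
small-multiplier₁ {a} {b} 0≤a 0<a with ∣ b ∣ ℚ.≤? a
... | yes ∣b∣≤a = 1ℚ , 0<1 , subst (ℚ._≤ a) (sym (ℚP.*-identityˡ ∣ b ∣)) ∣b∣≤a
... | no ∣b∣≰a = a * 1/ ∣ b ∣ , 0<ε , ℚP.≤-reflexive ε∣b∣≡a
  where
  0<∣b∣ : 0ℚ ℚ.< ∣ b ∣
  0<∣b∣ = ℚP.≤-<-trans 0≤a (ℚP.≰⇒> ∣b∣≰a)
  instance
    _ = ℚ.>-nonZero 0<∣b∣
    _ = ℚ.positive (0<a (λ b≡0 → ℚP.<⇒≢ 0<∣b∣ (sym (cong ∣_∣ b≡0))))
    _ = ℚP.1/pos⇒pos ∣ b ∣ {{ℚ.positive 0<∣b∣}}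
  0<ε : 0ℚ ℚ.< a * 1/ ∣ b ∣
  0<ε = ℚP.positive⁻¹ _ {{ℚP.pos*pos⇒pos a (1/ ∣ b ∣)}}
  ε∣b∣≡a : a * 1/ ∣ b ∣ * ∣ b ∣ ≡ a
  ε∣b∣≡a = trans (ℚP.*-assoc a _ _) (trans (cong (a *_) (ℚP.*-inverseˡ ∣ b ∣)) (ℚP.*-identityʳ a))

small-multiplier : {A : Set} (xs : List A) (a b : A → ℚ) →
  (∀ x → 0ℚ ℚ.≤ a x) → (∀ x → b x ≢ 0ℚ → 0ℚ ℚ.< a x) →
  ∃[ ε ] 0ℚ ℚ.< ε × (∀ {x} → x ∈ xs → ε * ∣ b x ∣ ℚ.≤ a x)
small-multiplier [] a b _ _ = 1ℚ , 0<1 , λ ()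
small-multiplier (x ∷ xs) a b 0≤a 0<a
  with small-multiplier₁ (0≤a x) (0<a x) | small-multiplier xs a b 0≤a 0<a
... | ε₀ , 0<ε₀ , bound₀ | ε , 0<ε , bound = ε₀ ⊓ ε , 0<ε₀⊓ε , λ where
    (here refl)  → shrink (ℚP.p⊓q≤p ε₀ ε) bound₀
    (there x∈xs) → shrink (ℚP.p⊓q≤q ε₀ ε) (bound x∈xs)
  where
  0<ε₀⊓ε : 0ℚ ℚ.< ε₀ ⊓ ε
  0<ε₀⊓ε with ℚP.⊓-sel ε₀ ε
  ... | inj₁ ⊓≡ε₀ = subst (0ℚ ℚ.<_) (sym ⊓≡ε₀) 0<ε₀
  ... | inj₂ ⊓≡ε  = subst (0ℚ ℚ.<_) (sym ⊓≡ε) 0<ε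
  shrink : ∀ {e c q} → ε₀ ⊓ ε ℚ.≤ e → e * ∣ c ∣ ℚ.≤ q → (ε₀ ⊓ ε) * ∣ c ∣ ℚ.≤ q
  shrink {c = c} ⊓≤e e∣c∣≤q = ℚP.≤-trans (ℚP.*-monoʳ-≤-nonNeg ∣ c ∣ {{ℚP.∣-∣-nonNeg c}} ⊓≤e) e∣c∣≤q

Tuple : ℕ → ℕ → Set
Tuple n m = Vec (Fin n) m

infix 4 _≟ᵗ_
_≟ᵗ_ : ∀ {n m} (s t : Tuple n m) → Dec (s ≡ t)
_≟ᵗ_ = ≡-decⱽ _≟ᶠ_

indicator : ∀ {n m} → Tuple n m → Point n m
indicator s t = χ (t ≟ᵗ s)

indicator-self : ∀ {n m} (s : Tuple n m) → indicator s s ≡ 1ℚ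
indicator-self s = χ-yes (s ≟ᵗ s) refl

indicator-other : ∀ {n m} {s t : Tuple n m} → t ≢ s → indicator s t ≡ 0ℚ
indicator-other {s = s} {t} t≢s = χ-no (t ≟ᵗ s) t≢s

∈-tuples : ∀ {n} m (s : Tuple n m) → s ∈ tuples n m
∈-tuples zero    []      = here refl
∈-tuples (suc m) (a ∷ s) = ∈-concat⁺′ (∈-map⁺ (a ∷_) (∈-tuples m s)) (∈-map⁺ _ (∈-allFin a))

∃-tuple? : ∀ {n m} {P : Tuple n m → Set} → (∀ t → Dec (P t)) → Dec (∃ P)
∃-tuple? {n} {m} P? with Any.any? P? (tuples n m)
... | yes p  = yes (Any.satisfied p)
... | no ¬p  = no (λ (t , pt) → ¬p (lose (∈-tuples m t) pt))

Σℚ-tuples-suc : ∀ {n} m (f : Tuple n (suc m) → ℚ) →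
  Σℚ (tuples n (suc m)) f ≡ sum (λ a → Σℚ (tuples n m) (f ∘ (a ∷_)))
Σℚ-tuples-suc {n} m f = begin
  Σℚ (tuples n (suc m)) f                                 ≡⟨ Σℚ-concatMap _ (allFin n) f ⟩
  Σℚ (allFin n) (λ a → Σℚ (map (a ∷_) (tuples n m)) f)     ≡⟨ Σℚ-cong (allFin n) (λ a → Σℚ-map (a ∷_) (tuples n m) f) ⟩
  Σℚ (allFin n) (λ a → Σℚ (tuples n m) (f ∘ (a ∷_)))       ≡⟨ Σℚ-tabulate {k = n} id _ ⟩
  sum (λ a → Σℚ (tuples n m) (f ∘ (a ∷_)))                 ∎

Σℚ-tuples-single : ∀ {n} m (s : Tuple n m) {f : Point n m} → (∀ t → t ≢ s → f t ≡ 0ℚ) →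
  Σℚ (tuples n m) f ≡ f s
Σℚ-tuples-single zero    []      f-off = ℚP.+-identityʳ _
Σℚ-tuples-single {n} (suc m) (a ∷ s) {f} f-off = begin
  Σℚ (tuples n (suc m)) f                       ≡⟨ Σℚ-tuples-suc m f ⟩
  sum (λ b → Σℚ (tuples n m) (f ∘ (b ∷_)))       ≡⟨ sum-single a (λ b b≢a → Σℚ-zero (tuples n m) (λ t → f-off (b ∷ t) (b≢a ∘ ∷-injectiveˡ))) ⟩
  Σℚ (tuples n m) (f ∘ (a ∷_))                   ≡⟨ Σℚ-tuples-single m s (λ t t≢s → f-off (a ∷ t) (t≢s ∘ ∷-injectiveʳ)) ⟩
  f (a ∷ s)                                     ∎

Σℚ-tuples-image : ∀ {n m k} (τ : Fin k → Tuple n m) → Injective _≡_ _≡_ τ → {f : Point n m} →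
  (∀ t → (∀ r → t ≢ τ r) → f t ≡ 0ℚ) → Σℚ (tuples n m) f ≡ sum (f ∘ τ)
Σℚ-tuples-image {n} {m} {k} τ τ-injective {f} f-off = begin
  Σℚ (tuples n m) f                                               ≡⟨ Σℚ-cong (tuples n m) expand ⟩
  Σℚ (tuples n m) (λ t → sum (λ r → f (τ r) * indicator (τ r) t))   ≡⟨ Σℚ-combination (tuples n m) (f ∘ τ) (indicator ∘ τ) ⟩
  sum (λ r → f (τ r) * Σℚ (tuples n m) (indicator (τ r)))           ≡⟨ sum-cong-≗ (λ r → cong (f (τ r) *_) (mass-indicator r)) ⟩
  sum (λ r → f (τ r) * 1ℚ)                                        ≡⟨ sum-cong-≗ (λ r → ℚP.*-identityʳ (f (τ r))) ⟩
  sum (f ∘ τ)                                                     ∎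
  where
  mass-indicator : ∀ r → Σℚ (tuples n m) (indicator (τ r)) ≡ 1ℚ
  mass-indicator r = trans (Σℚ-tuples-single m (τ r) (λ t → indicator-other)) (indicator-self (τ r))
  expand : ∀ t → f t ≡ sum (λ r → f (τ r) * indicator (τ r) t)
  expand t with any? (λ r → t ≟ᵗ τ r)
  ... | yes (r , refl) = sym (trans
        (sum-single r (λ r′ r′≢r → trans (cong (f (τ r′) *_) (indicator-other (r′≢r ∘ sym ∘ τ-injective))) (ℚP.*-zeroʳ (f (τ r′)))))
        (trans (cong (f (τ r) *_) (indicator-self (τ r))) (ℚP.*-identityʳ _)))
  ... | no ¬image = trans (f-off t (λ r t≡τr → ¬image (r , t≡τr)))
        (sym (trans (sum-cong-≗ (λ r → trans (cong (f (τ r) *_) (indicator-other (λ t≡τr → ¬image (r , t≡τr)))) (ℚP.*-zeroʳ (f (τ r)))))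
                    (sum-replicate-zero k)))

-- Linear dependence

record LinearDependence {d k : ℕ} (v : Fin k → Vector ℚ d) : Set where
  field
    coefficient     : Vector ℚ k
    nonzero         : Fin k
    coefficient≢0   : coefficient nonzero ≢ 0ℚ
    combination≡0   : ∀ c → sum (λ r → coefficient r * v r c) ≡ 0ℚ

-- One elimination step: α r is the multiple of the pivot v p that clears the first coordinate of
-- v (punchIn p r).
module Elimination {d : ℕ} (v : Fin (suc (suc d)) → Vector ℚ (suc d)) (p : Fin (suc (suc d)))
  (α : Vector ℚ (suc d)) where

  residual : Fin (suc d) → Vector ℚ (suc d)
  residual r c = v (punchIn p r) c - α r * v p c

  reduced : Fin (suc d) → Vector ℚ d
  reduced r c = residual r (suc c)

  lift : (∀ r → v (punchIn p r) zero ≡ α r * v p zero) → LinearDependence reduced → LinearDependence v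
  lift first-column D = record
    { coefficient   = insertAt μ p (- S)
    ; nonzero       = punchIn p r₀
    ; coefficient≢0 = μr₀≢0 ∘ trans (sym (insertAt-punchIn μ p (- S) r₀))
    ; combination≡0 = combination≡0
    }
    where
    open LinearDependence D renaming (coefficient to μ; nonzero to r₀; coefficient≢0 to μr₀≢0; combination≡0 to μ-reduced≡0)
    S : ℚ
    S = sum (λ r → μ r * α r)
    μ-residual≡0 : ∀ c → sum (λ r → μ r * residual r c) ≡ 0ℚ
    μ-residual≡0 zero    = trans (sum-cong-≗ (λ r → trans (cong (λ x → μ r * (x - α r * v p zero)) (first-column r))
                                   (trans (cong (μ r *_) (ℚP.+-inverseʳ (α r * v p zero))) (ℚP.*-zeroʳ (μ r)))))
                                 (sum-replicate-zero (suc d))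
    μ-residual≡0 (suc c) = μ-reduced≡0 c
    others : ∀ c → sum (λ r → μ r * v (punchIn p r) c) ≡ S * v p c
    others c = begin
      sum (λ r → μ r * v (punchIn p r) c)
        ≡⟨ sum-cong-≗ (λ r → solve 4 (λ m x a w → m :* x := m :* (x :- a :* w) :+ m :* a :* w) refl (μ r) (v (punchIn p r) c) (α r) (v p c)) ⟩
      sum (λ r → μ r * residual r c + μ r * α r * v p c)
        ≡⟨ ∑-distrib-+ (λ r → μ r * residual r c) (λ r → μ r * α r * v p c) ⟩
      sum (λ r → μ r * residual r c) + sum (λ r → μ r * α r * v p c)
        ≡⟨ cong₂ _+_ (μ-residual≡0 c) (sym (*-distribʳ-sum (v p c) (λ r → μ r * α r))) ⟩
      0ℚ + S * v p c
        ≡⟨ ℚP.+-identityˡ (S * v p c) ⟩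
      S * v p c ∎
    combination≡0 : ∀ c → sum (λ r → insertAt μ p (- S) r * v r c) ≡ 0ℚ
    combination≡0 c = begin
      sum (λ r → insertAt μ p (- S) r * v r c)
        ≡⟨ sum-remove {i = p} (λ r → insertAt μ p (- S) r * v r c) ⟩
      insertAt μ p (- S) p * v p c + sum (λ r → insertAt μ p (- S) (punchIn p r) * v (punchIn p r) c)
        ≡⟨ cong₂ _+_ (cong (_* v p c) (insertAt-lookup μ p (- S)))
                     (sum-cong-≗ (λ r → cong (_* v (punchIn p r) c) (insertAt-punchIn μ p (- S) r))) ⟩
      - S * v p c + sum (λ r → μ r * v (punchIn p r) c)
        ≡⟨ cong (- S * v p c +_) (others c) ⟩
      - S * v p c + S * v p c
        ≡⟨ solve 2 (λ s w → :- s :* w :+ s :* w := con 0ℚ) refl S (v p c) ⟩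
      0ℚ ∎

dependent : ∀ d (v : Fin (suc d) → Vector ℚ d) → LinearDependence v
dependent zero v = record { coefficient = λ _ → 1ℚ ; nonzero = zero ; coefficient≢0 = λ () ; combination≡0 = λ () }
dependent (suc d) v with any? (λ r → ¬? (v r zero ℚ.≟ 0ℚ))
... | yes (p , vp≢0) = Elimination.lift v p α first-column (dependent d _)
  where
  instance _ = ℚ.≢-nonZero vp≢0
  α : Vector ℚ (suc d)
  α r = v (punchIn p r) zero * 1/ v p zero
  first-column : ∀ r → v (punchIn p r) zero ≡ α r * v p zero
  first-column r = sym (trans (ℚP.*-assoc (v (punchIn p r) zero) (1/ v p zero) (v p zero))
    (trans (cong (v (punchIn p r) zero *_) (ℚP.*-inverseˡ (v p zero))) (ℚP.*-identityʳ (v (punchIn p r) zero))))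
... | no ¬pivot = Elimination.lift v zero (λ _ → 0ℚ) first-column (dependent d _)
  where
  first-column : ∀ r → v (suc r) zero ≡ 0ℚ * v zero zero
  first-column r = trans (decidable-stable (v (suc r) zero ℚ.≟ 0ℚ) (λ v≢0 → ¬pivot (suc r , v≢0))) (sym (ℚP.*-zeroˡ (v zero zero)))

-- Flows and vertices of H

flow : ∀ {n m} → Point n m → Fin n → ℚ
flow {n} {m} y k = Σℚ (tuples n m) (λ i → y i * coeff i k)

mass : ∀ {n m} → Point n m → ℚ
mass {n} {m} y = Σℚ (tuples n m) y

infix 4 _⊆ˢ_
_⊆ˢ_ : ∀ {n m} → Point n m → Point n m → Set
z ⊆ˢ y = ∀ t → y t ≡ 0ℚ → z t ≡ 0ℚ

module _ {n m : ℕ} where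

  flow-perturb : (y z : Point n m) (e : ℚ) (c : Fin n) → flow (λ t → y t + e * z t) c ≡ flow y c + e * flow z c
  flow-perturb y z e c = trans
    (Σℚ-cong (tuples n m) (λ t → solve 4 (λ y e z g → (y :+ e :* z) :* g := y :* g :+ e :* (z :* g)) refl (y t) e (z t) (coeff t c)))
    (Σℚ-perturb (tuples n m) (λ t → y t * coeff t c) (λ t → z t * coeff t c) e)

  mass-perturb : (y z : Point n m) (e : ℚ) → mass (λ t → y t + e * z t) ≡ mass y + e * mass z
  mass-perturb y z = Σℚ-perturb (tuples n m) y z

  flow-combination : ∀ {k} (a : Vector ℚ k) (p : Fin k → Point n m) (c : Fin n) →
    flow (λ t → sum (λ r → a r * p r t)) c ≡ sum (λ r → a r * flow (p r) c)
  flow-combination a p c = trans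
    (Σℚ-cong (tuples n m) (λ t → trans (*-distribʳ-sum (coeff t c) (λ r → a r * p r t))
                                        (sum-cong-≗ (λ r → ℚP.*-assoc (a r) (p r t) (coeff t c)))))
    (Σℚ-combination (tuples n m) a (λ r t → p r t * coeff t c))

  mass-combination : ∀ {k} (a : Vector ℚ k) (p : Fin k → Point n m) →
    mass (λ t → sum (λ r → a r * p r t)) ≡ sum (λ r → a r * mass (p r))
  mass-combination a p = Σℚ-combination (tuples n m) a p

sum-coeff : ∀ {n m} (s : Tuple n m) → sum (coeff s) ≡ 0ℚ
sum-coeff {n} []                = sum-replicate-zero n
sum-coeff {n} {suc m} (a ∷ rest) = begin
  sum (coeff (a ∷ rest))
    ≡⟨ sum-- (λ c → ℕ→ℚ m * δ a c) (λ c → Σℚ (Vec.toList rest) (λ i → δ i c)) ⟩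
  sum (λ c → ℕ→ℚ m * δ a c) - sum (λ c → Σℚ (Vec.toList rest) (λ i → δ i c))
    ≡⟨ cong₂ _-_ (sym (*-distribˡ-sum (ℕ→ℚ m) (δ a))) (sym (Σℚ-sum-comm (Vec.toList rest) δ)) ⟩
  ℕ→ℚ m * sum (δ a) - Σℚ (Vec.toList rest) (λ i → sum (δ i))
    ≡⟨ cong₂ _-_ (cong (ℕ→ℚ m *_) (sum-δ a)) (Σℚ-cong (Vec.toList rest) sum-δ) ⟩
  ℕ→ℚ m * 1ℚ - Σℚ (Vec.toList rest) (λ _ → 1ℚ)
    ≡⟨ cong (_-_ (ℕ→ℚ m * 1ℚ)) (trans (Σℚ-const (Vec.toList rest) 1ℚ) (cong (λ l → ℕ→ℚ l * 1ℚ) (length-toList rest))) ⟩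
  ℕ→ℚ m * 1ℚ - ℕ→ℚ m * 1ℚ
    ≡⟨ ℚP.+-inverseʳ (ℕ→ℚ m * 1ℚ) ⟩
  0ℚ ∎

sum-flow : ∀ {n m} (y : Point n m) → sum (flow y) ≡ 0ℚ
sum-flow {n} {m} y = begin
  sum (flow y)                                             ≡⟨ Σℚ-sum-comm (tuples n m) (λ t c → y t * coeff t c) ⟨
  Σℚ (tuples n m) (λ t → sum (λ c → y t * coeff t c))      ≡⟨ Σℚ-zero (tuples n m) (λ t → trans (sym (*-distribˡ-sum (y t) (coeff t)))
                                                                                     (trans (cong (y t *_) (sum-coeff t)) (ℚP.*-zeroʳ (y t)))) ⟩
  0ℚ                                                       ∎

flow≡0-from-others : ∀ {n m} (y : Point n m) (j : Fin n) → (∀ c → c ≢ j → flow y c ≡ 0ℚ) → flow y j ≡ 0ℚ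
flow≡0-from-others y j others = trans (sym (sum-single j others)) (sum-flow y)

HasFirst? : ∀ {n m} (s : Tuple n m) (k : Fin n) → Dec (HasFirst s k)
HasFirst? []      k = no (λ ())
HasFirst? (a ∷ s) k = a ≟ᶠ k

HasFirst-unique : ∀ {n m} {s : Tuple n m} {a b : Fin n} → HasFirst s a → HasFirst s b → a ≡ b
HasFirst-unique {s = _ ∷ _} s₁≡a s₁≡b = trans (sym s₁≡a) s₁≡b

coeff-nonPos : ∀ {n m} (s : Tuple n m) (c : Fin n) → ¬ HasFirst s c → coeff s c ℚ.≤ 0ℚ
coeff-nonPos [] c _ = ℚP.≤-refl
coeff-nonPos {m = suc m} (a ∷ rest) c a≢c =
  subst (ℚ._≤ 0ℚ) (sym coeff≡-Σ) (ℚP.neg-antimono-≤ (Σℚ-nonNeg (Vec.toList rest) (λ i → δ-nonNeg i c)))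
  where
  Σδ = Σℚ (Vec.toList rest) (λ i → δ i c)
  coeff≡-Σ : coeff (a ∷ rest) c ≡ - Σδ
  coeff≡-Σ = begin
    ℕ→ℚ m * δ a c - Σδ    ≡⟨ cong (λ x → ℕ→ℚ m * x - Σδ) (δ-≢ a≢c) ⟩
    ℕ→ℚ m * 0ℚ - Σδ       ≡⟨ cong (_- Σδ) (ℚP.*-zeroʳ (ℕ→ℚ m)) ⟩
    0ℚ - Σδ               ≡⟨ ℚP.+-identityˡ (- Σδ) ⟩
    - Σδ                  ∎

coeff≡0-on-support : ∀ {n m} {y : Point n m} {c : Fin n} → InH n m y → (∀ s → HasFirst s c → y s ≡ 0ℚ) →
  ∀ s → y s ≢ 0ℚ → coeff s c ≡ 0ℚ
coeff≡0-on-support {n} {m} {y} {c} (balanced , _ , nonNeg) off s y-s≢0 =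
  p*q≡0⇒q≡0 y-s≢0 (Σℚ-nonPos-≡0 (tuples n m) term≤0 (balanced c) (∈-tuples m s))
  where
  term≤0 : ∀ t → y t * coeff t c ℚ.≤ 0ℚ
  term≤0 t with HasFirst? t c
  ... | yes first = ℚP.≤-reflexive (trans (cong (_* coeff t c) (off t first)) (ℚP.*-zeroˡ (coeff t c)))
  ... | no ¬first = p*q≤0 (nonNeg t) (coeff-nonPos t c ¬first)

flow-supported≡0 : ∀ {n m} {y z : Point n m} {c : Fin n} → InH n m y → (∀ s → HasFirst s c → y s ≡ 0ℚ) →
  z ⊆ˢ y → flow z c ≡ 0ℚ
flow-supported≡0 {n} {m} {y} {z} {c} y∈H off z⊆y = Σℚ-zero (tuples n m) term≡0
  where
  term≡0 : ∀ t → z t * coeff t c ≡ 0ℚ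
  term≡0 t with y t ℚ.≟ 0ℚ
  ... | yes yt≡0 = trans (cong (_* coeff t c) (z⊆y t yt≡0)) (ℚP.*-zeroˡ (coeff t c))
  ... | no yt≢0  = trans (cong (z t *_) (coeff≡0-on-support y∈H off t yt≢0)) (ℚP.*-zeroʳ (z t))

perturbation∈H : ∀ {n m} {y z : Point n m} {e : ℚ} → InH n m y → (∀ c → flow z c ≡ 0ℚ) → mass z ≡ 0ℚ →
  (∀ t → ∣ e ∣ * ∣ z t ∣ ℚ.≤ y t) → InH n m (λ t → y t + e * z t)
perturbation∈H {y = y} {z} {e} (balanced , mass≡1 , _) z-balanced z-mass small = balanced′ , mass′ , nonNeg′
  where
  balanced′ : ∀ c → flow (λ t → y t + e * z t) c ≡ 0ℚ
  balanced′ c = trans (flow-perturb y z e c) (trans (cong₂ (λ a b → a + e * b) (balanced c) (z-balanced c))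
                  (solve 1 (λ e → con 0ℚ :+ e :* con 0ℚ := con 0ℚ) refl e))
  mass′ : mass (λ t → y t + e * z t) ≡ 1ℚ
  mass′ = trans (mass-perturb y z e) (trans (cong₂ (λ a b → a + e * b) mass≡1 z-mass)
            (solve 1 (λ e → con 1ℚ :+ e :* con 0ℚ := con 1ℚ) refl e))
  nonNeg′ : ∀ t → 0ℚ ℚ.≤ y t + e * z t
  nonNeg′ t = ∣q∣≤p⇒0≤p+q (subst (ℚ._≤ y t) (sym (ℚP.∣p*q∣≡∣p∣*∣q∣ e (z t))) (small t))

vertex-rigid : ∀ {n m} {y : Point n m} → IsVertex n m y → (z : Point n m) →
  (∀ c → flow z c ≡ 0ℚ) → mass z ≡ 0ℚ → z ⊆ˢ y → ∀ t → z t ≡ 0ℚ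
vertex-rigid {n} {m} {y} (y∈H@(_ , _ , nonNeg) , extreme) z z-balanced z-mass z⊆y t =
  p*q≡0⇒q≡0 2ε≢0 2εz≡0
  where
  ε-spec = small-multiplier (tuples n m) y z nonNeg (λ t zt≢0 → ≤∧≢⇒< (nonNeg t) (λ 0≡yt → zt≢0 (z⊆y t (sym 0≡yt))))
  ε = proj₁ ε-spec
  0<ε : 0ℚ ℚ.< ε
  0<ε = proj₁ (proj₂ ε-spec)
  perturbed : ℚ → Point n m
  perturbed e t = y t + e * z t
  perturbed∈H : ∀ e → ∣ e ∣ ≡ ε → InH n m (perturbed e)
  perturbed∈H e ∣e∣≡ε = perturbation∈H {z = z} {e} y∈H z-balanced z-mass
    (λ t → subst (λ a → a * ∣ z t ∣ ℚ.≤ y t) (sym ∣e∣≡ε) (proj₂ (proj₂ ε-spec) (∈-tuples m t)))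
  ∣ε∣≡ε : ∣ ε ∣ ≡ ε
  ∣ε∣≡ε = ℚP.0≤p⇒∣p∣≡p (ℚP.<⇒≤ 0<ε)
  midpoint : ∀ t → y t ≡ ½ * perturbed ε t + (1ℚ - ½) * perturbed (- ε) t
  midpoint t = solve 3 (λ y e z → y := con ½ :* (y :+ e :* z) :+ (con 1ℚ :- con ½) :* (y :+ (:- e) :* z)) refl (y t) ε (z t)
  same : perturbed ε t ≡ perturbed (- ε) t
  same = extreme (perturbed ε) (perturbed (- ε)) ½ (perturbed∈H ε ∣ε∣≡ε) (perturbed∈H (- ε) (trans (ℚP.∣-p∣≡∣p∣ ε) ∣ε∣≡ε))
                 0<½ ½<1 midpoint t
  2ε≢0 : ε + ε ≢ 0ℚ
  2ε≢0 2ε≡0 = ℚP.<⇒≢ (ℚP.+-mono-< 0<ε 0<ε) (sym 2ε≡0)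
  2εz≡0 : (ε + ε) * z t ≡ 0ℚ
  2εz≡0 = begin
    (ε + ε) * z t                                     ≡⟨ solve 3 (λ y e z → (e :+ e) :* z := (y :+ e :* z) :- (y :+ (:- e) :* z)) refl (y t) ε (z t) ⟩
    perturbed ε t - perturbed (- ε) t                 ≡⟨ cong (_- perturbed (- ε) t) same ⟩
    perturbed (- ε) t - perturbed (- ε) t             ≡⟨ ℚP.+-inverseʳ (perturbed (- ε) t) ⟩
    0ℚ                                                ∎

convex-parts-⊆ˢ : ∀ {n m} {y y₁ y₂ : Point n m} {s : ℚ} → (∀ t → 0ℚ ℚ.≤ y₁ t) → (∀ t → 0ℚ ℚ.≤ y₂ t) →
  0ℚ ℚ.< s → s ℚ.< 1ℚ → (∀ t → y t ≡ s * y₁ t + (1ℚ - s) * y₂ t) → y₁ ⊆ˢ y × y₂ ⊆ˢ y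
convex-parts-⊆ˢ {y = y} {y₁} {y₂} {s} 0≤y₁ 0≤y₂ 0<s s<1 y≡ =
  (λ t yt≡0 → p*q≡0⇒q≡0 s≢0 (p+q≡0⇒p≡0-nonNeg (part₁ t) (part₂ t) (sum≡0 t yt≡0))) ,
  (λ t yt≡0 → p*q≡0⇒q≡0 1-s≢0 (p+q≡0⇒p≡0-nonNeg (part₂ t) (part₁ t) (trans (ℚP.+-comm ((1ℚ - s) * y₂ t) (s * y₁ t)) (sum≡0 t yt≡0))))
  where
  0<1-s : 0ℚ ℚ.< 1ℚ - s
  0<1-s = subst (ℚ._< 1ℚ - s) (ℚP.+-inverseʳ s) (ℚP.+-monoˡ-< (- s) s<1)
  s≢0 : s ≢ 0ℚ
  s≢0 s≡0 = ℚP.<⇒≢ 0<s (sym s≡0)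
  1-s≢0 : 1ℚ - s ≢ 0ℚ
  1-s≢0 1-s≡0 = ℚP.<⇒≢ 0<1-s (sym 1-s≡0)
  part₁ : ∀ t → 0ℚ ℚ.≤ s * y₁ t
  part₁ t = 0≤p*q (ℚP.<⇒≤ 0<s) (0≤y₁ t)
  part₂ : ∀ t → 0ℚ ℚ.≤ (1ℚ - s) * y₂ t
  part₂ t = 0≤p*q (ℚP.<⇒≤ 0<1-s) (0≤y₂ t)
  sum≡0 : ∀ t → y t ≡ 0ℚ → s * y₁ t + (1ℚ - s) * y₂ t ≡ 0ℚ
  sum≡0 t yt≡0 = trans (sym (y≡ t)) yt≡0

unique-in-support⇒vertex : ∀ {n m} {y : Point n m} → InH n m y →
  (∀ Y → InH n m Y → Y ⊆ˢ y → ∀ t → Y t ≡ y t) → IsVertex n m y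
unique-in-support⇒vertex y∈H unique = y∈H , λ y₁ y₂ s y₁∈H y₂∈H 0<s s<1 y≡ t →
  let y₁⊆y , y₂⊆y = convex-parts-⊆ˢ (proj₂ (proj₂ y₁∈H)) (proj₂ (proj₂ y₂∈H)) 0<s s<1 y≡
  in trans (unique y₁ y₁∈H y₁⊆y t) (sym (unique y₂ y₂∈H y₂⊆y t))

-- Two support tuples with the same first index

module SharedFirstIndex {n m : ℕ} {y : Point n m} (y-vertex : IsVertex n m y) {j : Fin n} {i i′ : Tuple n m}
  (first-i : HasFirst i j) (first-i′ : HasFirst i′ j) (y-i≢0 : y i ≢ 0ℚ) (y-i′≢0 : y i′ ≢ 0ℚ) (i≢i′ : i ≢ i′) where

  Rep : Fin n → Tuple n m → Set
  Rep k s = HasFirst s k × y s ≢ 0ℚ × s ≢ i′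

  rep? : ∀ k → Dec (∃ (Rep k))
  rep? k = ∃-tuple? (λ s → HasFirst? s k ×-dec ¬? (y s ℚ.≟ 0ℚ) ×-dec ¬? (s ≟ᵗ i′))

  rep-j : ∃ (Rep j)
  rep-j = i , first-i , y-i≢0 , i≢i′

  no-rep⇒outside-support : ∀ {k} → ¬ ∃ (Rep k) → k ≢ j → ∀ s → HasFirst s k → y s ≡ 0ℚ
  no-rep⇒outside-support {k} ¬rep k≢j s first = decidable-stable (y s ℚ.≟ 0ℚ) λ y-s≢0 →
    ¬rep (s , first , y-s≢0 , λ s≡i′ → k≢j (HasFirst-unique first (subst (λ t → HasFirst t j) (sym s≡i′) first-i′)))

  selected : Fin (suc n) → Maybe (Tuple n m)
  selected zero = just i′
  selected (suc k) with rep? k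
  ... | yes (s , _) = just s
  ... | no _        = nothing

  selected-rep : ∀ {k s} → selected (suc k) ≡ just s → Rep k s
  selected-rep {k} eq with rep? k | eq
  ... | yes (_ , rep) | refl = rep
  ... | no _          | ()

  selected-support : ∀ {r s} → selected r ≡ just s → y s ≢ 0ℚ
  selected-support {zero}  refl = y-i′≢0
  selected-support {suc k} eq   = proj₁ (proj₂ (selected-rep eq))

  selected-injective : ∀ {r r′ s} → selected r ≡ just s → selected r′ ≡ just s → r ≡ r′
  selected-injective {zero}  {zero}   _    _    = refl
  selected-injective {zero}  {suc k′} refl eq′  = ⊥-elim (proj₂ (proj₂ (selected-rep eq′)) refl)
  selected-injective {suc k} {zero}   eq   refl = ⊥-elim (proj₂ (proj₂ (selected-rep eq)) refl)
  selected-injective {suc k} {suc k′} eq   eq′  = cong suc (HasFirst-unique (proj₁ (selected-rep eq)) (proj₁ (selected-rep eq′)))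

  atom : Maybe (Tuple n m) → Point n m
  atom (just s) = indicator s
  atom nothing  = λ _ → 0ℚ

  atom-⊆ˢ : ∀ r → atom (selected r) ⊆ˢ y
  atom-⊆ˢ r t yt≡0 with selected r in eq
  ... | just s  = indicator-other (λ t≡s → selected-support {r} eq (subst (λ u → y u ≡ 0ℚ) t≡s yt≡0))
  ... | nothing = refl

  -- A first index k without representative contributes the unit vector e_k instead, so that
  -- there are always n + 1 vectors; its coefficient is forced to vanish (coefficient-unselected).
  pad : Fin (suc n) → Vector ℚ n
  pad zero    c = 0ℚ
  pad (suc k) c with rep? k
  ... | yes _ = 0ℚ
  ... | no _  = δ k c

  pad-off : ∀ c r → r ≢ suc c → pad r c ≡ 0ℚ
  pad-off c zero    _ = refl
  pad-off c (suc k) r≢suc-c with rep? k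
  ... | yes _ = refl
  ... | no _  = δ-≢ (r≢suc-c ∘ cong suc)

  -- Row j of A is minus the sum of the others (sum-flow), so it is replaced by the mass row.
  constraint : Point n m → Vector ℚ n
  constraint p c with c ≟ᶠ j
  ... | yes _ = mass p
  ... | no _  = flow p c

  column : Fin (suc n) → Vector ℚ n
  column r c = constraint (atom (selected r)) c + pad r c

  open LinearDependence (dependent n column)

  z : Point n m
  z t = sum (λ r → coefficient r * atom (selected r) t)

  z-⊆ˢ : z ⊆ˢ y
  z-⊆ˢ t yt≡0 = trans (sum-cong-≗ (λ r → trans (cong (coefficient r *_) (atom-⊆ˢ r t yt≡0)) (ℚP.*-zeroʳ (coefficient r))))
                      (sum-replicate-zero (suc n))

  constraint-z : ∀ c → constraint z c ≡ sum (λ r → coefficient r * constraint (atom (selected r)) c)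
  constraint-z c with c ≟ᶠ j
  ... | yes _ = mass-combination coefficient (atom ∘ selected)
  ... | no _  = flow-combination coefficient (atom ∘ selected) c

  balance : ∀ c → constraint z c + coefficient (suc c) * pad (suc c) c ≡ 0ℚ
  balance c = begin
    constraint z c + coefficient (suc c) * pad (suc c) c
      ≡⟨ cong₂ _+_ (constraint-z c) (sym (sum-single (suc c) (λ r r≢suc-c → trans (cong (coefficient r *_) (pad-off c r r≢suc-c)) (ℚP.*-zeroʳ (coefficient r))))) ⟩
    sum (λ r → coefficient r * constraint (atom (selected r)) c) + sum (λ r → coefficient r * pad r c)
      ≡⟨ ∑-distrib-+ (λ r → coefficient r * constraint (atom (selected r)) c) (λ r → coefficient r * pad r c) ⟨
    sum (λ r → coefficient r * constraint (atom (selected r)) c + coefficient r * pad r c)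
      ≡⟨ sum-cong-≗ (λ r → ℚP.*-distribˡ-+ (coefficient r) (constraint (atom (selected r)) c) (pad r c)) ⟨
    sum (λ r → coefficient r * column r c)
      ≡⟨ combination≡0 c ⟩
    0ℚ ∎

  pad-rep : ∀ {c} → ∃ (Rep c) → pad (suc c) c ≡ 0ℚ
  pad-rep {c} rep with rep? c
  ... | yes _   = refl
  ... | no ¬rep = ⊥-elim (¬rep rep)

  pad-no-rep : ∀ {c} → ¬ ∃ (Rep c) → pad (suc c) c ≡ 1ℚ
  pad-no-rep {c} ¬rep with rep? c
  ... | yes rep = ⊥-elim (¬rep rep)
  ... | no _    = δ-refl c

  constraint-off-j : ∀ p {c} → c ≢ j → constraint p c ≡ flow p c
  constraint-off-j p {c} c≢j with c ≟ᶠ j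
  ... | yes c≡j = ⊥-elim (c≢j c≡j)
  ... | no _    = refl

  constraint-j : ∀ p → constraint p j ≡ mass p
  constraint-j p with j ≟ᶠ j
  ... | yes _   = refl
  ... | no j≢j  = ⊥-elim (j≢j refl)

  balance-rep : ∀ {c} → ∃ (Rep c) → constraint z c ≡ 0ℚ
  balance-rep {c} rep = begin
    constraint z c                                        ≡⟨ ℚP.+-identityʳ (constraint z c) ⟨
    constraint z c + 0ℚ                                   ≡⟨ cong (constraint z c +_) (ℚP.*-zeroʳ (coefficient (suc c))) ⟨
    constraint z c + coefficient (suc c) * 0ℚ             ≡⟨ cong (λ x → constraint z c + coefficient (suc c) * x) (pad-rep rep) ⟨
    constraint z c + coefficient (suc c) * pad (suc c) c  ≡⟨ balance c ⟩
    0ℚ                                                    ∎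

  flow-z-off-j : ∀ c → c ≢ j → flow z c ≡ 0ℚ
  flow-z-off-j c c≢j with rep? c
  ... | yes rep = trans (sym (constraint-off-j z c≢j)) (balance-rep rep)
  ... | no ¬rep = flow-supported≡0 (proj₁ y-vertex) (no-rep⇒outside-support ¬rep c≢j) z-⊆ˢ

  flow-z : ∀ c → flow z c ≡ 0ℚ
  flow-z c with c ≟ᶠ j
  ... | yes refl = flow≡0-from-others z j flow-z-off-j
  ... | no c≢j   = flow-z-off-j c c≢j

  mass-z : mass z ≡ 0ℚ
  mass-z = trans (sym (constraint-j z)) (balance-rep rep-j)

  z≡0 : ∀ t → z t ≡ 0ℚ
  z≡0 = vertex-rigid y-vertex z flow-z mass-z z-⊆ˢ

  z-selected : ∀ {r s} → selected r ≡ just s → z s ≡ coefficient r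
  z-selected {r} {s} eq = begin
    z s                                   ≡⟨ sum-single r off ⟩
    coefficient r * atom (selected r) s   ≡⟨ cong (λ a → coefficient r * atom a s) eq ⟩
    coefficient r * indicator s s         ≡⟨ cong (coefficient r *_) (indicator-self s) ⟩
    coefficient r * 1ℚ                    ≡⟨ ℚP.*-identityʳ (coefficient r) ⟩
    coefficient r                         ∎
    where
    off : ∀ r′ → r′ ≢ r → coefficient r′ * atom (selected r′) s ≡ 0ℚ
    off r′ r′≢r with selected r′ in eq′
    ... | just s′ = trans (cong (coefficient r′ *_) (indicator-other (λ s≡s′ → r′≢r (selected-injective eq′ (trans eq (cong just s≡s′))))))
                          (ℚP.*-zeroʳ (coefficient r′))
    ... | nothing = ℚP.*-zeroʳ (coefficient r′)

  unselected⇒no-rep : ∀ {k} → selected (suc k) ≡ nothing → ¬ ∃ (Rep k)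
  unselected⇒no-rep {k} eq with rep? k | eq
  ... | yes _   | ()
  ... | no ¬rep | _ = ¬rep

  coefficient-unselected : ∀ k → selected (suc k) ≡ nothing → coefficient (suc k) ≡ 0ℚ
  coefficient-unselected k unselected = begin
    coefficient (suc k)                                   ≡⟨ ℚP.*-identityʳ (coefficient (suc k)) ⟨
    coefficient (suc k) * 1ℚ                              ≡⟨ cong (coefficient (suc k) *_) (pad-no-rep ¬rep) ⟨
    coefficient (suc k) * pad (suc k) k                   ≡⟨ ℚP.+-identityˡ (coefficient (suc k) * pad (suc k) k) ⟨
    0ℚ + coefficient (suc k) * pad (suc k) k              ≡⟨ cong (_+ coefficient (suc k) * pad (suc k) k) (trans (constraint-off-j z k≢j) (flow-z k)) ⟨
    constraint z k + coefficient (suc k) * pad (suc k) k  ≡⟨ balance k ⟩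
    0ℚ                                                    ∎
    where
    ¬rep : ¬ ∃ (Rep k)
    ¬rep = unselected⇒no-rep unselected
    k≢j : k ≢ j
    k≢j k≡j = ¬rep (subst (λ c → ∃ (Rep c)) (sym k≡j) rep-j)

  coefficient≡0 : ∀ r → coefficient r ≡ 0ℚ
  coefficient≡0 r with selected r in eq
  ... | just s  = trans (sym (z-selected eq)) (z≡0 s)
  ... | nothing = unselected r eq
    where
    unselected : ∀ r → selected r ≡ nothing → coefficient r ≡ 0ℚ
    unselected (suc k) eq = coefficient-unselected k eq

  impossible : ⊥
  impossible = coefficient≢0 (coefficient≡0 nonzero)

vertex-first-index-unique : ∀ {n m} (y : Point n m) → IsVertex n m y → (j : Fin n) (i i′ : Tuple n m) →
  HasFirst i j → HasFirst i′ j → ¬ (y i ≡ 0ℚ) → ¬ (y i′ ≡ 0ℚ) → i ≡ i′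
vertex-first-index-unique y y-vertex j i i′ first-i first-i′ y-i≢0 y-i′≢0 =
  decidable-stable (i ≟ᵗ i′) (SharedFirstIndex.impossible y-vertex first-i first-i′ y-i≢0 y-i′≢0)

-- A vertex supported on a cycle

inject₁≡suc⇒constant : ∀ {d} (W : Vector ℚ (suc d)) → (∀ l → W (inject₁ l) ≡ W (suc l)) → ∀ k → W k ≡ W zero
inject₁≡suc⇒constant         W step zero    = refl
inject₁≡suc⇒constant {suc d} W step (suc k) = trans (inject₁≡suc⇒constant (W ∘ suc) (step ∘ suc) k) (sym (step zero))

module Cycle (n′ m′ : ℕ) where

  prev : Fin (suc n′) → Fin (suc n′)
  prev zero    = fromℕ n′
  prev (suc k) = inject₁ k

  sum-∘prev : (f : Vector ℚ (suc n′)) → sum (f ∘ prev) ≡ sum f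
  sum-∘prev f = trans (ℚP.+-comm (f (fromℕ n′)) (sum (f ∘ inject₁))) (sym (sum-init-last f))

  prev≡inject₁ : ∀ {k l} → prev k ≡ inject₁ l → k ≡ suc l
  prev≡inject₁ {zero}  e = ⊥-elim (fromℕ≢inject₁ e)
  prev≡inject₁ {suc k} e = cong suc (inject₁-injective e)

  cycleTuple : Fin (suc n′) → Tuple (suc n′) (suc (suc m′))
  cycleTuple k = k ∷ prev k ∷ Vec.replicate m′ k

  coeff-cycleTuple : ∀ k c → coeff (cycleTuple k) c ≡ δ k c - δ (prev k) c
  coeff-cycleTuple k c = begin
    ℕ→ℚ (suc m′) * δ k c - (δ (prev k) c + Σℚ (Vec.toList (Vec.replicate m′ k)) (λ i → δ i c))
      ≡⟨ cong (λ xs → ℕ→ℚ (suc m′) * δ k c - (δ (prev k) c + Σℚ xs (λ i → δ i c))) (toList-replicate m′ k) ⟩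
    ℕ→ℚ (suc m′) * δ k c - (δ (prev k) c + Σℚ (List.replicate m′ k) (λ i → δ i c))
      ≡⟨ cong₂ (λ a b → a - (δ (prev k) c + b)) (ℕ→ℚ-suc-* m′ (δ k c)) (Σℚ-replicate m′ k (λ i → δ i c)) ⟩
    (δ k c + ℕ→ℚ m′ * δ k c) - (δ (prev k) c + ℕ→ℚ m′ * δ k c)
      ≡⟨ solve 3 (λ a b r → (a :+ r) :- (b :+ r) := a :- b) refl (δ k c) (δ (prev k) c) (ℕ→ℚ m′ * δ k c) ⟩
    δ k c - δ (prev k) c ∎

  OnCycle : Tuple (suc n′) (suc (suc m′)) → Set
  OnCycle t = ∃ λ k → t ≡ cycleTuple k

  onCycle? : ∀ t → Dec (OnCycle t)
  onCycle? t = any? (λ k → t ≟ᵗ cycleTuple k)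

  Σℚ-on-cycle : {f : Point (suc n′) (suc (suc m′))} → (∀ t → ¬ OnCycle t → f t ≡ 0ℚ) →
    Σℚ (tuples (suc n′) (suc (suc m′))) f ≡ sum (f ∘ cycleTuple)
  Σℚ-on-cycle f-off = Σℚ-tuples-image cycleTuple ∷-injectiveˡ (λ t ¬image → f-off t (λ (k , t≡τk) → ¬image k t≡τk))

  flow-on-cycle : (Y : Point (suc n′) (suc (suc m′))) → (∀ t → ¬ OnCycle t → Y t ≡ 0ℚ) → ∀ c →
    flow Y c ≡ sum (λ k → Y (cycleTuple k) * δ k c) - sum (λ k → Y (cycleTuple k) * δ (prev k) c)
  flow-on-cycle Y Y-off c = begin
    flow Y c
      ≡⟨ Σℚ-on-cycle (λ t ¬on → trans (cong (_* coeff t c) (Y-off t ¬on)) (ℚP.*-zeroˡ (coeff t c))) ⟩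
    sum (λ k → Y (cycleTuple k) * coeff (cycleTuple k) c)
      ≡⟨ sum-cong-≗ (λ k → trans (cong (Y (cycleTuple k) *_) (coeff-cycleTuple k c))
                                 (solve 3 (λ w a b → w :* (a :- b) := w :* a :- w :* b) refl (Y (cycleTuple k)) (δ k c) (δ (prev k) c))) ⟩
    sum (λ k → Y (cycleTuple k) * δ k c - Y (cycleTuple k) * δ (prev k) c)
      ≡⟨ sum-- (λ k → Y (cycleTuple k) * δ k c) (λ k → Y (cycleTuple k) * δ (prev k) c) ⟩
    sum (λ k → Y (cycleTuple k) * δ k c) - sum (λ k → Y (cycleTuple k) * δ (prev k) c) ∎

  instance
    n≢0 : ℚ.NonZero (ℕ→ℚ (suc n′))
    n≢0 = ℚ.>-nonZero (0<ℕ→ℚ-suc n′)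

  w : ℚ
  w = 1/ ℕ→ℚ (suc n′)

  0<w : 0ℚ ℚ.< w
  0<w = ℚP.positive⁻¹ w {{ℚP.1/pos⇒pos (ℕ→ℚ (suc n′)) {{ℚ.positive (0<ℕ→ℚ-suc n′)}}}}

  uniform : Point (suc n′) (suc (suc m′))
  uniform t = χ (onCycle? t) * w

  uniform-off : ∀ t → ¬ OnCycle t → uniform t ≡ 0ℚ
  uniform-off t ¬on = trans (cong (_* w) (χ-no (onCycle? t) ¬on)) (ℚP.*-zeroˡ w)

  uniform-on : ∀ k → uniform (cycleTuple k) ≡ w
  uniform-on k = trans (cong (_* w) (χ-yes (onCycle? (cycleTuple k)) (k , refl))) (ℚP.*-identityˡ w)

  uniform∈H : InH (suc n′) (suc (suc m′)) uniform
  uniform∈H = balanced , mass≡1 , λ t → 0≤p*q (χ-nonNeg (onCycle? t)) (ℚP.<⇒≤ 0<w)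
    where
    balanced : ∀ c → flow uniform c ≡ 0ℚ
    balanced c = begin
      flow uniform c                                                         ≡⟨ flow-on-cycle uniform uniform-off c ⟩
      sum (λ k → uniform (cycleTuple k) * δ k c) - sum (λ k → uniform (cycleTuple k) * δ (prev k) c)
        ≡⟨ cong₂ _-_ (sum-cong-≗ (λ k → cong (_* δ k c) (uniform-on k))) (sum-cong-≗ (λ k → cong (_* δ (prev k) c) (uniform-on k))) ⟩
      sum (λ k → w * δ k c) - sum (λ k → w * δ (prev k) c)              ≡⟨ cong (_-_ (sum (λ k → w * δ k c))) (sum-∘prev (λ k → w * δ k c)) ⟩
      sum (λ k → w * δ k c) - sum (λ k → w * δ k c)                     ≡⟨ ℚP.+-inverseʳ (sum (λ k → w * δ k c)) ⟩
      0ℚ                                                                ∎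
    mass≡1 : mass uniform ≡ 1ℚ
    mass≡1 = begin
      mass uniform                          ≡⟨ Σℚ-on-cycle uniform-off ⟩
      sum (uniform ∘ cycleTuple)            ≡⟨ sum-cong-≗ uniform-on ⟩
      sum (replicate (suc n′) w)       ≡⟨ sum-const (suc n′) w ⟩
      ℕ→ℚ (suc n′) * w                 ≡⟨ ℚP.*-inverseʳ (ℕ→ℚ (suc n′)) ⟩
      1ℚ                               ∎

  unique-on-cycle : ∀ Y → InH (suc n′) (suc (suc m′)) Y → Y ⊆ˢ uniform → ∀ t → Y t ≡ uniform t
  unique-on-cycle Y (balanced , mass≡1 , _) Y⊆uniform t = by-cases (onCycle? t)
    where
    Y-off : ∀ t → ¬ OnCycle t → Y t ≡ 0ℚ
    Y-off t ¬on = Y⊆uniform t (uniform-off t ¬on)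
    W : Vector ℚ (suc n′)
    W = Y ∘ cycleTuple
    step : ∀ l → W (inject₁ l) ≡ W (suc l)
    step l = begin
      W (inject₁ l)                                  ≡⟨ sum-*δ W (inject₁ l) ⟨
      sum (λ k → W k * δ k (inject₁ l))              ≡⟨ p-q≡0⇒p≡q (trans (sym (flow-on-cycle Y Y-off (inject₁ l))) (balanced (inject₁ l))) ⟩
      sum (λ k → W k * δ (prev k) (inject₁ l))       ≡⟨ sum-single (suc l) (λ k k≢suc-l → trans (cong (W k *_) (δ-≢ (k≢suc-l ∘ prev≡inject₁))) (ℚP.*-zeroʳ (W k))) ⟩
      W (suc l) * δ (inject₁ l) (inject₁ l)          ≡⟨ cong (W (suc l) *_) (δ-refl (inject₁ l)) ⟩
      W (suc l) * 1ℚ                                 ≡⟨ ℚP.*-identityʳ (W (suc l)) ⟩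
      W (suc l)                                      ∎
    W₀≡w : W zero ≡ w
    W₀≡w = *-cancelˡ-≢0 (ℚP.<⇒≢ (0<ℕ→ℚ-suc n′) ∘ sym) (begin
      ℕ→ℚ (suc n′) * W zero             ≡⟨ sum-const (suc n′) (W zero) ⟨
      sum (replicate (suc n′) (W zero)) ≡⟨ sum-cong-≗ (inject₁≡suc⇒constant W step) ⟨
      sum W                             ≡⟨ Σℚ-on-cycle Y-off ⟨
      mass Y                            ≡⟨ mass≡1 ⟩
      1ℚ                                ≡⟨ ℚP.*-inverseʳ (ℕ→ℚ (suc n′)) ⟨
      ℕ→ℚ (suc n′) * w                  ∎)
    by-cases : Dec (OnCycle t) → Y t ≡ uniform t
    by-cases (yes (k , t≡τk)) = subst (λ u → Y u ≡ uniform u) (sym t≡τk) (trans (inject₁≡suc⇒constant W step k) (trans W₀≡w (sym (uniform-on k))))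
    by-cases (no ¬on)         = trans (Y-off t ¬on) (sym (uniform-off t ¬on))

  nnz-uniform : nnz (suc n′) (suc (suc m′)) uniform ≡ suc n′
  nnz-uniform = ℕ→ℚ-injective (begin
    ℕ→ℚ (nnz (suc n′) (suc (suc m′)) uniform)                    ≡⟨ ℕ→ℚ-length-filter (λ t → ¬? (uniform t ℚ.≟ 0ℚ)) (tuples (suc n′) (suc (suc m′))) ⟩
    Σℚ (tuples (suc n′) (suc (suc m′))) (λ t → χ (¬? (uniform t ℚ.≟ 0ℚ)))
      ≡⟨ Σℚ-on-cycle (λ t ¬on → χ-no (¬? (uniform t ℚ.≟ 0ℚ)) (λ u≢0 → u≢0 (uniform-off t ¬on))) ⟩
    sum (λ k → χ (¬? (uniform (cycleTuple k) ℚ.≟ 0ℚ)))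
      ≡⟨ sum-cong-≗ (λ k → χ-yes (¬? (uniform (cycleTuple k) ℚ.≟ 0ℚ)) (λ u≡0 → ℚP.<⇒≢ 0<w (sym (trans (sym (uniform-on k)) u≡0)))) ⟩
    sum (replicate (suc n′) 1ℚ)                              ≡⟨ sum-const (suc n′) 1ℚ ⟩
    ℕ→ℚ (suc n′) * 1ℚ                                        ≡⟨ ℚP.*-identityʳ (ℕ→ℚ (suc n′)) ⟩
    ℕ→ℚ (suc n′)                                             ∎)

  vertex : Σ (Point (suc n′) (suc (suc m′))) (λ y → IsVertex (suc n′) (suc (suc m′)) y × nnz (suc n′) (suc (suc m′)) y ≡ suc n′)
  vertex = uniform , unique-in-support⇒vertex uniform∈H unique-on-cycle , nnz-uniform

theorem4 : (n m : ℕ) → 1 ≤ n → 2 ≤ m →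
    ((y : Point n m) → IsVertex n m y →
      (j : Fin n) (i i′ : Vec (Fin n) m) → HasFirst i j → HasFirst i′ j →
        ¬ (y i ≡ 0ℚ) → ¬ (y i′ ≡ 0ℚ) → i ≡ i′)
    × Σ (Point n m) (λ y → IsVertex n m y × nnz n m y ≡ n)
theorem4 (suc n′) (suc (suc m′)) _ _ = vertex-first-index-unique , Cycle.vertex n′ m′
theorem4 zero    _             () _
theorem4 (suc _) zero          _  ()
theorem4 (suc _) (suc zero)    _  (s≤s ())
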